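{- Let $\mathbf{a}=(a_i)_{i\in\mathbb{Z}}$ be pairwise distinct indeterminates (or complex numbers chosen so that all denominators below are nonzero), and let $A_{\mathbf a}(n,k)$ be the generalized Eulerian numbers. Then $A_{\mathbf a}(n,k)=0$ for $k<0$ or $k>n$, $A_{\mathbf a}(0,0)=1$, and for all $n\ge 0$ and $k\ge 0$, \[ A_{\mathbf a}(n+1,k)=a_{n-k+2}\,A_{\mathbf a}(n,k-1)-a_{ -k}\,P(n,k)\,A_{\mathbf a}(n,k), \qquad\text{where}\qquad P(n,k)=\prod_{i=1}^{n+1}\frac{a_{n-k+2}-a_{i-k}}{a_{n-k+1}-a_{i-1-k}}. \]
   Context: For $n\ge 0$, the generalized Eulerian numbers $A_{\mathbf a}(n,k)$, $0\le k\le n$, are defined as the (unique) coefficients in the polynomial identity in the variable $z$ \[ z^n=\sum_{k=0}^{n} A_{\mathbf a}(n,k)\prod_{i=1}^{n}\frac{z-a_{i-k}}{a_{n-k+1}-a_{i-k}}, \] and one sets $A_{\mathbf a}(n,k)=0$ for $k<0$ or $k>n$. -}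

module Defs where

open import Level using (Level; _⊔_; suc)
open import Data.Nat as ℕ using (ℕ) renaming (suc to sucℕ; zero to zeroℕ)
open import Data.Integer as ℤ using (ℤ; +_) renaming (_+_ to _+ℤ_; _-_ to _-ℤ_; -_ to -ℤ_; _<_ to _<ℤ_)
open import Data.Product using (Σ; _×_)
open import Data.Sum using (_⊎_)
open import Relation.Nullary using (¬_)
open import Relation.Binary.PropositionalEquality using (_≡_)
open import Algebra.Bundles using (CommutativeRing)

-- A field: a commutative ring with 0 ≠ 1 and a (total) inverse operation
-- that is a genuine multiplicative inverse on every nonzero element
-- (the value of 0⁻¹ is irrelevant and never used in the statement since
-- all denominators are nonzero under the injectivity hypothesis).
record Field (c ℓ : Level) : Set (Level.suc (c ⊔ ℓ)) where
  field
    commutativeRing : CommutativeRing c ℓ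
  open CommutativeRing commutativeRing public
  field
    _⁻¹      : Carrier → Carrier
    0≉1      : ¬ (0# ≈ 1#)
    ⁻¹-inverse : ∀ x → ¬ (x ≈ 0#) → (x * (x ⁻¹)) ≈ 1#

module FieldOps {c ℓ : Level} (F : Field c ℓ) where
  open Field F hiding (zero)

  pow : Carrier → ℕ → Carrier
  pow z zeroℕ = 1#
  pow z (sucℕ n) = pow z n * z

  _÷_ : Carrier → Carrier → Carrier
  x ÷ y = x * (y ⁻¹)

  sum0 : ℕ → (ℕ → Carrier) → Carrier
  sum0 zeroℕ f = f zeroℕ
  sum0 (sucℕ n) f = sum0 n f + f (sucℕ n)

  prod1 : ℕ → (ℕ → Carrier) → Carrier
  prod1 zeroℕ f = 1#
  prod1 (sucℕ n) f = prod1 n f * f (sucℕ n)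

  IsGenEulerian : (ℤ → Carrier) → (ℕ → ℤ → Carrier) → Set (c ⊔ ℓ)
  IsGenEulerian a A =
    (∀ (n : ℕ) (k : ℤ) → (k <ℤ + 0 ⊎ + n <ℤ k) → A n k ≈ 0#)
    × (∀ (n : ℕ) (z : Carrier) →
         pow z n ≈ sum0 n (λ k → A n (+ k) *
           prod1 n (λ i → (z - a (+ i -ℤ + k))
                        ÷ (a (+ n -ℤ + k +ℤ + 1) - a (+ i -ℤ + k)))))

  P : (ℤ → Carrier) → ℕ → ℕ → Carrier
  P a n k = prod1 (sucℕ n) (λ i →
    (a (+ n -ℤ + k +ℤ + 2) - a (+ i -ℤ + k))
      ÷ (a (+ n -ℤ + k +ℤ + 1) - a (+ i -ℤ + 1 -ℤ + k)))

  EulerianRecurrence : (ℤ → Carrier) → (ℕ → ℤ → Carrier) → Set ℓ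
  EulerianRecurrence a A =
    (∀ (n : ℕ) (k : ℤ) → (k <ℤ + 0 ⊎ + n <ℤ k) → A n k ≈ 0#)
    × (A 0 (+ 0) ≈ 1#)
    × (∀ (n k : ℕ) →
         A (sucℕ n) (+ k) ≈
           (a (+ n -ℤ + k +ℤ + 2) * A n (+ k -ℤ + 1)
             - a (-ℤ (+ k)) * P a n k * A n (+ k)))

-- Write b(n,k) for the polynomial multiplying A(n,k) in the defining identity.  It vanishes at
-- a_{1-k}, …, a_{n-k} and equals 1 at the node a_{n-k+1}.  Comparing the linear factors of
-- b(n,k), b(n+1,k) and b(n+1,k+1) gives
--   z b(n,k)(z) = - a_{-k} P(n,k) b(n+1,k)(z) + a_{n-k+1} b(n+1,k+1)(z),
-- so multiplying an expansion of z^n by z and collecting coefficients gives an expansion of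
-- z^{n+1} whose coefficients are the right-hand side of the recurrence; by induction on n
-- this constructs the numbers.  Expansions are unique: b(m,k) vanishes at the nodes a_{m-j+1}
-- with k < j ≤ m, so evaluating at those nodes determines the coefficients from the top index
-- down.  Uniqueness turns the constructed expansion into the recurrence for any A.
module Submission where

open import Defs
open import Level using (Level)
open import Data.Integer using (ℤ)
open import Data.Product using (Σ; _×_; _,_)
open import Relation.Binary.PropositionalEquality using (_≡_)

open import Level using (_⊔_)
open import Data.Integer using (+_; -[1+_]; +<+; -<+)
  renaming (_+_ to _+ℤ_; _-_ to _-ℤ_; -_ to -ℤ_; _<_ to _<ℤ_)
import Data.Integer.Properties as ℤP
open import Data.Integer.Tactic.RingSolver using (solve-∀)
open import Data.Nat as ℕ using (ℕ; zero; suc; z≤n; s≤s)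
import Data.Nat.Properties as ℕP
open import Data.Sum using (_⊎_; inj₁; inj₂)
open import Data.Empty using (⊥-elim)
open import Function using (_∘_)
open import Relation.Nullary using (¬_; yes; no)
open import Relation.Binary.Definitions using (tri<; tri≈; tri>)
import Relation.Binary.PropositionalEquality as ≡
import Algebra.Properties.CommutativeSemigroup

[i-j]+1≡[1+i]-j : ∀ i j → i -ℤ j +ℤ + 1 ≡ (+ 1 +ℤ i) -ℤ j
[i-j]+1≡[1+i]-j = solve-∀

[i-j]+2≡[1+i]-j+1 : ∀ i j → i -ℤ j +ℤ + 2 ≡ (+ 1 +ℤ i) -ℤ j +ℤ + 1
[i-j]+2≡[1+i]-j+1 = solve-∀

[1+i]-[1+j]≡i-j : ∀ i j → (+ 1 +ℤ i) -ℤ (+ 1 +ℤ j) ≡ i -ℤ j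
[1+i]-[1+j]≡i-j = solve-∀

i-1-j≡i-[1+j] : ∀ i j → i -ℤ + 1 -ℤ j ≡ i -ℤ (+ 1 +ℤ j)
i-1-j≡i-[1+j] = solve-∀

i-[1+j]+2≡i-j+1 : ∀ i j → i -ℤ (+ 1 +ℤ j) +ℤ + 2 ≡ i -ℤ j +ℤ + 1
i-[1+j]+2≡i-j+1 = solve-∀

[i+j]-j≡i : ∀ i j → (i +ℤ j) -ℤ j ≡ i
[i+j]-j≡i = solve-∀

[j+i]-j+1≡1+i : ∀ i j → (j +ℤ i) -ℤ j +ℤ + 1 ≡ + 1 +ℤ i
[j+i]-j+1≡1+i = solve-∀

[1+j]-1≡j : ∀ j → (+ 1 +ℤ j) -ℤ + 1 ≡ j
[1+j]-1≡j = solve-∀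

[i-j]+j≡i : ∀ i j → (i -ℤ j) +ℤ j ≡ i
[i-j]+j≡i = solve-∀

-j≡0-j : ∀ j → -ℤ j ≡ + 0 -ℤ j
-j≡0-j = solve-∀

+m-k≡+n-k⇒m≡n : ∀ {m n k} → + m -ℤ + k ≡ + n -ℤ + k → m ≡ n
+m-k≡+n-k⇒m≡n {m} {n} {k} eq = ℤP.+-injective (begin
  + m                 ≡⟨ [i-j]+j≡i (+ m) (+ k) ⟨
  (+ m -ℤ + k) +ℤ + k ≡⟨ ≡.cong (_+ℤ + k) eq ⟩
  (+ n -ℤ + k) +ℤ + k ≡⟨ [i-j]+j≡i (+ n) (+ k) ⟩
  + n                 ∎)
  where open ≡.≡-Reasoning

module FieldProperties {c ℓ : Level} (F : Field c ℓ) where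
  open Field F hiding (zero)
  open FieldOps F
  open import Relation.Binary.Reasoning.Setoid setoid
  open import Algebra.Properties.AbelianGroup +-abelianGroup public
    using (x∙y⁻¹≈ε⇒x≈y; x≈y⇒x∙y⁻¹≈ε; ⁻¹-∙-comm; ⁻¹-anti-homo‿-; ε⁻¹≈ε)
  open import Algebra.Properties.Ring ring public using (x[y-z]≈xy-xz; [y-z]x≈yx-zx)
  module *-CS = Algebra.Properties.CommutativeSemigroup *-commutativeSemigroup
  module +-CS = Algebra.Properties.CommutativeSemigroup +-commutativeSemigroup

  [x-y]-[z-y]≈x-z : ∀ x y z → (x - y) - (z - y) ≈ x - z
  [x-y]-[z-y]≈x-z x y z = begin
    (x - y) - (z - y)      ≈⟨ +-congˡ (⁻¹-anti-homo‿- z y) ⟩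
    (x - y) + (y - z)      ≈⟨ +-assoc x (- y) (y - z) ⟩
    x + (- y + (y - z))    ≈⟨ +-congˡ (+-assoc (- y) y (- z)) ⟨
    x + ((- y + y) - z)    ≈⟨ +-congˡ (+-congʳ (-‿inverseˡ y)) ⟩
    x + (0# - z)           ≈⟨ +-congˡ (+-identityˡ (- z)) ⟩
    x - z                  ∎

  x[z-y]-y[z-x]≈z[x-y] : ∀ x y z → x * (z - y) - y * (z - x) ≈ z * (x - y)
  x[z-y]-y[z-x]≈z[x-y] x y z = begin
    x * (z - y) - y * (z - x)        ≈⟨ +-cong (x[y-z]≈xy-xz x z y) (-‿cong (x[y-z]≈xy-xz y z x)) ⟩
    (x * z - x * y) - (y * z - y * x) ≈⟨ +-congˡ (-‿cong (+-congˡ (-‿cong (*-comm y x)))) ⟩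
    (x * z - x * y) - (y * z - x * y) ≈⟨ [x-y]-[z-y]≈x-z (x * z) (x * y) (y * z) ⟩
    x * z - y * z                    ≈⟨ +-cong (*-comm x z) (-‿cong (*-comm y z)) ⟩
    z * x - z * y                    ≈⟨ x[y-z]≈xy-xz z x y ⟨
    z * (x - y)                      ∎

  NonZero : Carrier → Set ℓ
  NonZero x = ¬ (x ≈ 0#)

  NonZero-resp : ∀ {x y} → x ≈ y → NonZero y → NonZero x
  NonZero-resp x≈y y≉0 x≈0 = y≉0 (trans (sym x≈y) x≈0)

  ⁻¹-inverseˡ : ∀ x → NonZero x → x ⁻¹ * x ≈ 1#
  ⁻¹-inverseˡ x x≉0 = trans (*-comm _ _) (⁻¹-inverse x x≉0)

  *-cancelʳ : ∀ {x y z} → NonZero x → y * x ≈ z * x → y ≈ z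
  *-cancelʳ {x} {y} {z} x≉0 eq = begin
    y                ≈⟨ *-identityʳ y ⟨
    y * 1#           ≈⟨ *-congˡ (⁻¹-inverse x x≉0) ⟨
    y * (x * x ⁻¹)   ≈⟨ *-assoc y x (x ⁻¹) ⟨
    (y * x) * x ⁻¹   ≈⟨ *-congʳ eq ⟩
    (z * x) * x ⁻¹   ≈⟨ *-assoc z x (x ⁻¹) ⟩
    z * (x * x ⁻¹)   ≈⟨ *-congˡ (⁻¹-inverse x x≉0) ⟩
    z * 1#           ≈⟨ *-identityʳ z ⟩
    z                ∎

  *-nonZero : ∀ {x y} → NonZero x → NonZero y → NonZero (x * y)
  *-nonZero {x} {y} x≉0 y≉0 xy≈0 = y≉0 (begin
    y              ≈⟨ *-identityˡ y ⟨
    1# * y         ≈⟨ *-congʳ (⁻¹-inverseˡ x x≉0) ⟨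
    (x ⁻¹ * x) * y ≈⟨ *-assoc _ _ _ ⟩
    x ⁻¹ * (x * y) ≈⟨ *-congˡ xy≈0 ⟩
    x ⁻¹ * 0#      ≈⟨ zeroʳ _ ⟩
    0#             ∎)

  ÷-*-cancel : ∀ x {y} → NonZero y → (x ÷ y) * y ≈ x
  ÷-*-cancel x {y} y≉0 = begin
    (x * y ⁻¹) * y ≈⟨ *-assoc _ _ _ ⟩
    x * (y ⁻¹ * y) ≈⟨ *-congˡ (⁻¹-inverseˡ y y≉0) ⟩
    x * 1#         ≈⟨ *-identityʳ x ⟩
    x              ∎

  prod1-cong : ∀ n {f g : ℕ → Carrier} →
    (∀ i → 1 ℕ.≤ i → i ℕ.≤ n → f i ≈ g i) → prod1 n f ≈ prod1 n g
  prod1-cong zero    f≈g = refl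
  prod1-cong (suc n) f≈g =
    *-cong (prod1-cong n (λ i 1≤i i≤n → f≈g i 1≤i (ℕP.m≤n⇒m≤1+n i≤n)))
           (f≈g (suc n) (s≤s z≤n) ℕP.≤-refl)

  prod1-nonZero : ∀ n {f : ℕ → Carrier} →
    (∀ i → 1 ℕ.≤ i → i ℕ.≤ n → NonZero (f i)) → NonZero (prod1 n f)
  prod1-nonZero zero    f≉0 = 0≉1 ∘ sym
  prod1-nonZero (suc n) f≉0 =
    *-nonZero (prod1-nonZero n (λ i 1≤i i≤n → f≉0 i 1≤i (ℕP.m≤n⇒m≤1+n i≤n)))
              (f≉0 (suc n) (s≤s z≤n) ℕP.≤-refl)

  prod1-zero : ∀ n {f : ℕ → Carrier} i → 1 ℕ.≤ i → i ℕ.≤ n → f i ≈ 0# → prod1 n f ≈ 0#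
  prod1-zero zero    (suc i) _ () _
  prod1-zero (suc n) i 1≤i i≤1+n fi≈0 with i ℕ.≟ suc n
  ... | yes ≡.refl = trans (*-congˡ fi≈0) (zeroʳ _)
  ... | no  i≢1+n  = trans (*-congʳ (prod1-zero n i 1≤i i≤n fi≈0)) (zeroˡ _)
    where i≤n = ℕP.m<1+n⇒m≤n (ℕP.≤∧≢⇒< i≤1+n i≢1+n)

  prod1-one : ∀ n → prod1 n (λ _ → 1#) ≈ 1#
  prod1-one zero    = refl
  prod1-one (suc n) = trans (*-congʳ (prod1-one n)) (*-identityˡ 1#)

  prod1-÷ : ∀ n (f g : ℕ → Carrier) → (∀ i → 1 ℕ.≤ i → i ℕ.≤ n → NonZero (g i)) →
    prod1 n (λ i → f i ÷ g i) * prod1 n g ≈ prod1 n f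
  prod1-÷ zero    f g g≉0 = *-identityˡ 1#
  prod1-÷ (suc n) f g g≉0 = begin
    (prod1 n (λ i → f i ÷ g i) * (f (suc n) ÷ g (suc n))) * (prod1 n g * g (suc n))
      ≈⟨ *-CS.interchange _ _ _ _ ⟩
    (prod1 n (λ i → f i ÷ g i) * prod1 n g) * ((f (suc n) ÷ g (suc n)) * g (suc n))
      ≈⟨ *-cong (prod1-÷ n f g (λ i 1≤i i≤n → g≉0 i 1≤i (ℕP.m≤n⇒m≤1+n i≤n)))
                (÷-*-cancel (f (suc n)) (g≉0 (suc n) (s≤s z≤n) ℕP.≤-refl)) ⟩
    prod1 n f * f (suc n) ∎

  prod1-suc : ∀ n (f : ℕ → Carrier) → prod1 (suc n) f ≈ f 1 * prod1 n (f ∘ suc)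
  prod1-suc zero    f = *-comm _ _
  prod1-suc (suc n) f = trans (*-congʳ (prod1-suc n f)) (*-assoc _ _ _)

  sum0-cong : ∀ n {f g : ℕ → Carrier} → (∀ k → k ℕ.≤ n → f k ≈ g k) → sum0 n f ≈ sum0 n g
  sum0-cong zero    f≈g = f≈g 0 z≤n
  sum0-cong (suc n) f≈g =
    +-cong (sum0-cong n (λ k k≤n → f≈g k (ℕP.m≤n⇒m≤1+n k≤n))) (f≈g (suc n) ℕP.≤-refl)

  sum0-+ : ∀ n (f g : ℕ → Carrier) → sum0 n (λ k → f k + g k) ≈ sum0 n f + sum0 n g
  sum0-+ zero    f g = refl
  sum0-+ (suc n) f g = trans (+-congʳ (sum0-+ n f g)) (+-CS.interchange _ _ _ _)

  sum0-neg : ∀ n (f : ℕ → Carrier) → sum0 n (λ k → - f k) ≈ - sum0 n f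
  sum0-neg zero    f = refl
  sum0-neg (suc n) f = trans (+-congʳ (sum0-neg n f)) (⁻¹-∙-comm _ _)

  sum0-- : ∀ n (f g : ℕ → Carrier) → sum0 n (λ k → f k - g k) ≈ sum0 n f - sum0 n g
  sum0-- n f g = trans (sum0-+ n f (λ k → - g k)) (+-congˡ (sum0-neg n g))

  sum0-*ʳ : ∀ n (f : ℕ → Carrier) x → sum0 n f * x ≈ sum0 n (λ k → f k * x)
  sum0-*ʳ zero    f x = refl
  sum0-*ʳ (suc n) f x = trans (distribʳ x _ _) (+-congʳ (sum0-*ʳ n f x))

  sum0-suc : ∀ n (f : ℕ → Carrier) → sum0 (suc n) f ≈ f 0 + sum0 n (f ∘ suc)
  sum0-suc zero    f = refl
  sum0-suc (suc n) f = trans (+-congʳ (sum0-suc n f)) (+-assoc _ _ _)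

  sum0-zero : ∀ n (f : ℕ → Carrier) → (∀ k → k ℕ.≤ n → f k ≈ 0#) → sum0 n f ≈ 0#
  sum0-zero n f f≈0 = trans (sum0-cong n f≈0) (sum0-zero′ n)
    where
    sum0-zero′ : ∀ n → sum0 n (λ _ → 0#) ≈ 0#
    sum0-zero′ zero    = refl
    sum0-zero′ (suc n) = trans (+-congʳ (sum0-zero′ n)) (+-identityˡ 0#)

  sum0-single : ∀ n (f : ℕ → Carrier) j → j ℕ.≤ n →
    (∀ k → k ℕ.≤ n → ¬ k ≡ j → f k ≈ 0#) → sum0 n f ≈ f j
  sum0-single zero f .zero z≤n _ = refl
  sum0-single (suc n) f j j≤1+n f≈0 with j ℕ.≟ suc n
  ... | yes ≡.refl = trans (+-congʳ (sum0-zero n f (λ k k≤n → f≈0 k (ℕP.m≤n⇒m≤1+n k≤n)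
                                                     (ℕP.<⇒≢ (s≤s k≤n)))))
                           (+-identityˡ _)
  ... | no  j≢1+n  = trans (+-congˡ (f≈0 (suc n) ℕP.≤-refl (j≢1+n ∘ ≡.sym)))
                     (trans (+-identityʳ _)
                            (sum0-single n f j (ℕP.m<1+n⇒m≤n (ℕP.≤∧≢⇒< j≤1+n j≢1+n))
                                         (λ k k≤n → f≈0 k (ℕP.m≤n⇒m≤1+n k≤n))))

  sum0-pascal : ∀ n (f g : ℕ → Carrier) → f 0 ≈ 0# → g (suc n) ≈ 0# →
    sum0 (suc n) (λ k → f k + g k) ≈ sum0 n (λ k → f (suc k) + g k)
  sum0-pascal n f g f0≈0 g[1+n]≈0 = begin
    sum0 (suc n) (λ k → f k + g k)             ≈⟨ sum0-+ (suc n) f g ⟩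
    sum0 (suc n) f + (sum0 n g + g (suc n))    ≈⟨ +-cong (sum0-suc n f) (+-congˡ g[1+n]≈0) ⟩
    (f 0 + sum0 n (f ∘ suc)) + (sum0 n g + 0#) ≈⟨ +-cong (trans (+-congʳ f0≈0) (+-identityˡ _))
                                                         (+-identityʳ _) ⟩
    sum0 n (f ∘ suc) + sum0 n g                 ≈⟨ sum0-+ n (f ∘ suc) g ⟨
    sum0 n (λ k → f (suc k) + g k)             ∎

module GeneralizedEulerian {c ℓ : Level} (F : Field c ℓ) (a : ℤ → Field.Carrier F)
  (a-injective : ∀ i j → Field._≈_ F (a i) (a j) → i ≡ j) where
  open Field F hiding (zero)
  open FieldOps F
  open FieldProperties F
  open import Relation.Binary.Reasoning.Setoid setoid

  a-cong : ∀ {i j} → i ≡ j → a i ≈ a j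
  a-cong i≡j = reflexive (≡.cong a i≡j)

  node : ℕ → ℕ → Carrier
  node n k = a (+ n -ℤ + k +ℤ + 1)

  node-suc-suc : ∀ n k → node (suc n) (suc k) ≈ node n k
  node-suc-suc n k = a-cong (≡.cong (_+ℤ + 1) ([1+i]-[1+j]≡i-j (+ n) (+ k)))

  node-gap-nonZero : ∀ n k {i} → i ℕ.≤ n → NonZero (node n k - a (+ i -ℤ + k))
  node-gap-nonZero n k {i} i≤n gap≈0 = ℕP.<⇒≢ (s≤s i≤n) (≡.sym (+m-k≡+n-k⇒m≡n {k = k}
    (≡.trans (≡.sym ([i-j]+1≡[1+i]-j (+ n) (+ k))) (a-injective _ _ (x∙y⁻¹≈ε⇒x≈y _ _ gap≈0)))))

  node-a[-k]-nonZero : ∀ n k → NonZero (node n k - a (-ℤ + k))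
  node-a[-k]-nonZero n k =
    NonZero-resp (+-congˡ (-‿cong (a-cong (-j≡0-j (+ k))))) (node-gap-nonZero n k z≤n)

  numerator : ℕ → ℕ → Carrier → Carrier
  numerator n k z = prod1 n (λ i → z - a (+ i -ℤ + k))

  basis : ℕ → ℕ → Carrier → Carrier
  basis n k z = prod1 n (λ i → (z - a (+ i -ℤ + k)) ÷ (node n k - a (+ i -ℤ + k)))

  denominator : ℕ → ℕ → Carrier
  denominator n k = numerator n k (node n k)

  IsExpansion : ℕ → (ℕ → Carrier) → Set (c ⊔ ℓ)
  IsExpansion m c = ∀ z → pow z m ≈ sum0 m (λ k → c k * basis m k z)

  basis-at-own-node : ∀ m k → basis m k (node m k) ≈ 1#
  basis-at-own-node m k = trans
    (prod1-cong m (λ i _ i≤m → ⁻¹-inverse _ (node-gap-nonZero m k i≤m))) (prod1-one m)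

  -- With m = j + t, the factor i = 1 + t + k of basis m k vanishes at node m j = a (1 + t).
  basis-at-later-node : ∀ m {k j} → k ℕ.< j → j ℕ.≤ m → basis m k (node m j) ≈ 0#
  basis-at-later-node m {k} {j} k<j j≤m with ℕP.m≤n⇒∃[o]m+o≡n j≤m
  ... | t , ≡.refl = prod1-zero (j ℕ.+ t) (suc t ℕ.+ k) (s≤s z≤n) i≤m factor≈0
    where
    i≤m : suc t ℕ.+ k ℕ.≤ j ℕ.+ t
    i≤m = ℕP.≤-trans (ℕP.≤-reflexive (≡.sym (ℕP.+-suc t k)))
            (ℕP.≤-trans (ℕP.+-monoʳ-≤ t k<j) (ℕP.≤-reflexive (ℕP.+-comm t j)))
    factor≈0 : (node (j ℕ.+ t) j - a (+ (suc t ℕ.+ k) -ℤ + k))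
                 ÷ (node (j ℕ.+ t) k - a (+ (suc t ℕ.+ k) -ℤ + k)) ≈ 0#
    factor≈0 = trans (*-congʳ (x≈y⇒x∙y⁻¹≈ε (trans (a-cong ([j+i]-j+1≡1+i (+ t) (+ j)))
                                                   (sym (a-cong ([i+j]-j≡i (+ suc t) (+ k)))))))
                     (zeroˡ _)

  -- Downward induction on j (t bounds m - j): evaluating at node m j isolates c j once the
  -- coefficients above j are known to vanish.
  sum-basis≈0⇒coefficients≈0 : ∀ m (c : ℕ → Carrier) → (∀ z → sum0 m (λ k → c k * basis m k z) ≈ 0#) →
    ∀ j → j ℕ.≤ m → c j ≈ 0#
  sum-basis≈0⇒coefficients≈0 m c sum≈0 j j≤m =
    from-top (m ℕ.∸ j) j j≤m (ℕP.≤-reflexive (≡.sym (ℕP.m∸n+n≡m j≤m)))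
    where
    at-node : ∀ j → j ℕ.≤ m → (∀ k → j ℕ.< k → k ℕ.≤ m → c k ≈ 0#) → c j ≈ 0#
    at-node j j≤m above≈0 = begin
      c j                                    ≈⟨ *-identityʳ _ ⟨
      c j * 1#                               ≈⟨ *-congˡ (basis-at-own-node m j) ⟨
      c j * basis m j (node m j)             ≈⟨ sum0-single m _ j j≤m others≈0 ⟨
      sum0 m (λ k → c k * basis m k (node m j)) ≈⟨ sum≈0 (node m j) ⟩
      0#                                     ∎
      where
      others≈0 : ∀ k → k ℕ.≤ m → ¬ k ≡ j → c k * basis m k (node m j) ≈ 0#
      others≈0 k k≤m k≢j with ℕP.<-cmp k j
      ... | tri< k<j _ _ = trans (*-congˡ (basis-at-later-node m k<j j≤m)) (zeroʳ _)
      ... | tri≈ _ k≡j _ = ⊥-elim (k≢j k≡j)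
      ... | tri> _ _ j<k = trans (*-congʳ (above≈0 k j<k k≤m)) (zeroˡ _)
    from-top : ∀ t j → j ℕ.≤ m → m ℕ.≤ t ℕ.+ j → c j ≈ 0#
    from-top zero    j j≤m m≤j = at-node j j≤m λ k j<k k≤m →
      ⊥-elim (ℕP.<-irrefl ≡.refl (ℕP.<-≤-trans j<k (ℕP.≤-trans k≤m m≤j)))
    from-top (suc t) j j≤m m≤1+t+j = at-node j j≤m λ k j<k k≤m → from-top t k k≤m
      (ℕP.≤-trans m≤1+t+j (ℕP.≤-trans (ℕP.≤-reflexive (≡.sym (ℕP.+-suc t j)))
                                       (ℕP.+-monoʳ-≤ t j<k)))

  expansion-unique : ∀ m {c d : ℕ → Carrier} → IsExpansion m c → IsExpansion m d →
    ∀ k → k ℕ.≤ m → c k ≈ d k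
  expansion-unique m {c} {d} expand-c expand-d k k≤m =
    x∙y⁻¹≈ε⇒x≈y _ _ (sum-basis≈0⇒coefficients≈0 m (λ k → c k - d k) difference≈0 k k≤m)
    where
    difference≈0 : ∀ z → sum0 m (λ k → (c k - d k) * basis m k z) ≈ 0#
    difference≈0 z = begin
      sum0 m (λ k → (c k - d k) * basis m k z)
        ≈⟨ sum0-cong m (λ k _ → [y-z]x≈yx-zx _ _ _) ⟩
      sum0 m (λ k → c k * basis m k z - d k * basis m k z)
        ≈⟨ sum0-- m _ _ ⟩
      sum0 m (λ k → c k * basis m k z) - sum0 m (λ k → d k * basis m k z)
        ≈⟨ +-cong (expand-c z) (-‿cong (expand-d z)) ⟨
      pow z m - pow z m
        ≈⟨ -‿inverseʳ _ ⟩
      0# ∎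

  numerator-cong : ∀ n k {x y} → x ≈ y → numerator n k x ≈ numerator n k y
  numerator-cong n k x≈y = prod1-cong n (λ _ _ _ → +-congʳ x≈y)

  numerator-suc : ∀ n k z → numerator (suc n) k z ≈ numerator n k z * (z - node n k)
  numerator-suc n k z = *-congˡ (+-congˡ (-‿cong (a-cong (≡.sym ([i-j]+1≡[1+i]-j (+ n) (+ k))))))

  numerator-suc-suc : ∀ n k z → numerator (suc n) (suc k) z ≈ (z - a (-ℤ + k)) * numerator n k z
  numerator-suc-suc n k z = trans (prod1-suc n _) (*-cong
    (+-congˡ (-‿cong (a-cong (≡.trans ([1+i]-[1+j]≡i-j (+ 0) (+ k)) (≡.sym (-j≡0-j (+ k)))))))
    (prod1-cong n (λ i _ _ → +-congˡ (-‿cong (a-cong ([1+i]-[1+j]≡i-j (+ i) (+ k)))))))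

  basis-*-denominator : ∀ n k z → basis n k z * denominator n k ≈ numerator n k z
  basis-*-denominator n k z = prod1-÷ n _ _ (λ i _ i≤n → node-gap-nonZero n k i≤n)

  denominator-nonZero : ∀ n k → NonZero (denominator n k)
  denominator-nonZero n k = prod1-nonZero n (λ i _ i≤n → node-gap-nonZero n k i≤n)

  P-*-denominator : ∀ n k →
    P a n k * numerator (suc n) (suc k) (node n k) ≈ denominator (suc n) k
  P-*-denominator n k = begin
    P a n k * numerator (suc n) (suc k) (node n k)
      ≈⟨ *-congˡ (prod1-cong (suc n) (λ i _ _ → shift i)) ⟨
    P a n k * prod1 (suc n) (λ i → node n k - a (+ i -ℤ + 1 -ℤ + k))
      ≈⟨ prod1-÷ (suc n) _ _ (λ i _ i≤1+n →
           NonZero-resp (trans (shift i) (+-congʳ (sym (node-suc-suc n k))))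
                        (node-gap-nonZero (suc n) (suc k) i≤1+n)) ⟩
    prod1 (suc n) (λ i → a (+ n -ℤ + k +ℤ + 2) - a (+ i -ℤ + k))
      ≈⟨ prod1-cong (suc n) (λ i _ _ → +-congʳ (a-cong ([i-j]+2≡[1+i]-j+1 (+ n) (+ k)))) ⟩
    denominator (suc n) k ∎
    where
    shift : ∀ i → node n k - a (+ i -ℤ + 1 -ℤ + k) ≈ node n k - a (+ i -ℤ + suc k)
    shift i = +-congˡ (-‿cong (a-cong (i-1-j≡i-[1+j] (+ i) (+ k))))

  -- Multiplied by denominator n k, both sides become products of the linear factors z - a_i.
  basis-suc-suc : ∀ n k z → (node n k - a (-ℤ + k)) * basis (suc n) (suc k) z
                            ≈ (z - a (-ℤ + k)) * basis n k z
  basis-suc-suc n k z = *-cancelʳ (denominator-nonZero n k) (begin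
    ((u - w) * basis (suc n) (suc k) z) * D   ≈⟨ *-CS.xy∙z≈y∙xz _ _ _ ⟩
    basis (suc n) (suc k) z * ((u - w) * D)   ≈⟨ *-congˡ (numerator-suc-suc n k u) ⟨
    basis (suc n) (suc k) z * numerator (suc n) (suc k) u
      ≈⟨ *-congˡ (numerator-cong (suc n) (suc k) (node-suc-suc n k)) ⟨
    basis (suc n) (suc k) z * denominator (suc n) (suc k)
      ≈⟨ basis-*-denominator (suc n) (suc k) z ⟩
    numerator (suc n) (suc k) z               ≈⟨ numerator-suc-suc n k z ⟩
    (z - w) * numerator n k z                 ≈⟨ *-congˡ (basis-*-denominator n k z) ⟨
    (z - w) * (basis n k z * D)               ≈⟨ *-assoc _ _ _ ⟨
    ((z - w) * basis n k z) * D               ∎)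
    where
    u = node n k
    w = a (-ℤ + k)
    D = denominator n k

  basis-suc : ∀ n k z → (P a n k * (node n k - a (-ℤ + k))) * basis (suc n) k z
                        ≈ (z - node n k) * basis n k z
  basis-suc n k z = *-cancelʳ (denominator-nonZero n k) (begin
    ((P a n k * (u - w)) * basis (suc n) k z) * D   ≈⟨ *-CS.xy∙z≈y∙xz _ _ _ ⟩
    basis (suc n) k z * ((P a n k * (u - w)) * D)   ≈⟨ *-congˡ (*-assoc _ _ _) ⟩
    basis (suc n) k z * (P a n k * ((u - w) * D))   ≈⟨ *-congˡ (*-congˡ (numerator-suc-suc n k u)) ⟨
    basis (suc n) k z * (P a n k * numerator (suc n) (suc k) u)
      ≈⟨ *-congˡ (P-*-denominator n k) ⟩
    basis (suc n) k z * denominator (suc n) k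
      ≈⟨ basis-*-denominator (suc n) k z ⟩
    numerator (suc n) k z                           ≈⟨ numerator-suc n k z ⟩
    numerator n k z * (z - u)                       ≈⟨ *-congʳ (basis-*-denominator n k z) ⟨
    (basis n k z * D) * (z - u)                     ≈⟨ *-CS.xy∙z≈zx∙y _ _ _ ⟩
    ((z - u) * basis n k z) * D                     ∎)
    where
    u = node n k
    w = a (-ℤ + k)
    D = denominator n k

  *-basis : ∀ n k z → z * basis n k z
    ≈ node n k * basis (suc n) (suc k) z - (a (-ℤ + k) * P a n k) * basis (suc n) k z
  *-basis n k z = sym (*-cancelʳ (node-a[-k]-nonZero n k) (begin
    (u * b₂ - (w * P a n k) * b₁) * (u - w)
      ≈⟨ [y-z]x≈yx-zx _ _ _ ⟩
    (u * b₂) * (u - w) - ((w * P a n k) * b₁) * (u - w)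
      ≈⟨ +-cong (*-CS.xy∙z≈x∙zy _ _ _) (-‿cong w-term) ⟩
    u * ((u - w) * b₂) - w * ((P a n k * (u - w)) * b₁)
      ≈⟨ +-cong (*-congˡ (basis-suc-suc n k z)) (-‿cong (*-congˡ (basis-suc n k z))) ⟩
    u * ((z - w) * b) - w * ((z - u) * b)
      ≈⟨ +-cong (*-assoc _ _ _) (-‿cong (*-assoc _ _ _)) ⟨
    (u * (z - w)) * b - (w * (z - u)) * b
      ≈⟨ [y-z]x≈yx-zx _ _ _ ⟨
    (u * (z - w) - w * (z - u)) * b
      ≈⟨ *-congʳ (x[z-y]-y[z-x]≈z[x-y] u w z) ⟩
    (z * (u - w)) * b
      ≈⟨ *-CS.xy∙z≈xz∙y _ _ _ ⟩
    (z * b) * (u - w) ∎))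
    where
    u = node n k
    w = a (-ℤ + k)
    b = basis n k z
    b₁ = basis (suc n) k z
    b₂ = basis (suc n) (suc k) z
    w-term : ((w * P a n k) * b₁) * (u - w) ≈ w * ((P a n k * (u - w)) * b₁)
    w-term = trans (*-assoc _ _ _) (trans (*-assoc _ _ _) (*-congˡ (*-CS.x∙yz≈xz∙y _ _ _)))

  VanishesOutside : ℕ → (ℤ → Carrier) → Set ℓ
  VanishesOutside n g = ∀ j → j <ℤ + 0 ⊎ + n <ℤ j → g j ≈ 0#

  recurrenceRHS : (ℤ → Carrier) → ℕ → ℕ → Carrier
  recurrenceRHS g n k =
    a (+ n -ℤ + k +ℤ + 2) * g (+ k -ℤ + 1) - a (-ℤ (+ k)) * P a n k * g (+ k)

  recurrenceRHS-vanishes : ∀ n {g k} → VanishesOutside n g → suc n ℕ.< k →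
    recurrenceRHS g n k ≈ 0#
  recurrenceRHS-vanishes n {g} {suc k} g≈0 (s≤s n<k) = begin
    recurrenceRHS g n (suc k)
      ≈⟨ +-cong (trans (*-congˡ (trans (reflexive (≡.cong g ([1+j]-1≡j (+ k))))
                                       (g≈0 (+ k) (inj₂ (+<+ n<k)))))
                       (zeroʳ _))
                (-‿cong (trans (*-congˡ (g≈0 (+ suc k) (inj₂ (+<+ (ℕP.m<n⇒m<1+n n<k)))))
                               (zeroʳ _))) ⟩
    0# - 0#
      ≈⟨ -‿inverseʳ 0# ⟩
    0# ∎

  expansion-suc : ∀ n {g} → VanishesOutside n g → IsExpansion n (g ∘ +_) →
    IsExpansion (suc n) (recurrenceRHS g n)
  expansion-suc n {g} g≈0 expand z = begin
    pow z n * z                                      ≈⟨ *-congʳ (expand z) ⟩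
    sum0 n (λ k → g (+ k) * basis n k z) * z         ≈⟨ sum0-*ʳ n _ z ⟩
    sum0 n (λ k → (g (+ k) * basis n k z) * z)       ≈⟨ sum0-cong n (λ k _ → shifted+kept k) ⟨
    sum0 n (λ k → shifted (suc k) + kept k)          ≈⟨ sum0-pascal n shifted kept shifted₀ kept₁₊ₙ ⟨
    sum0 (suc n) (λ k → shifted k + kept k)          ≈⟨ sum0-cong (suc n) (λ k _ → [y-z]x≈yx-zx _ _ _) ⟨
    sum0 (suc n) (λ k → recurrenceRHS g n k * basis (suc n) k z) ∎
    where
    shifted kept : ℕ → Carrier
    shifted k = (a (+ n -ℤ + k +ℤ + 2) * g (+ k -ℤ + 1)) * basis (suc n) k z
    kept k = - ((a (-ℤ + k) * P a n k * g (+ k)) * basis (suc n) k z)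
    shifted₀ : shifted 0 ≈ 0#
    shifted₀ = trans (*-congʳ (trans (*-congˡ (g≈0 _ (inj₁ -<+))) (zeroʳ _))) (zeroˡ _)
    kept₁₊ₙ : kept (suc n) ≈ 0#
    kept₁₊ₙ = trans (-‿cong (trans (*-congʳ (trans (*-congˡ (g≈0 _ (inj₂ (+<+ ℕP.≤-refl))))
                                                   (zeroʳ _)))
                                   (zeroˡ _)))
                    ε⁻¹≈ε
    shifted+kept : ∀ k → shifted (suc k) + kept k ≈ (g (+ k) * basis n k z) * z
    shifted+kept k = begin
      shifted (suc k) + kept k
        ≈⟨ +-congʳ (*-congʳ (*-cong (a-cong (i-[1+j]+2≡i-j+1 (+ n) (+ k)))
                                    (reflexive (≡.cong g ([1+j]-1≡j (+ k)))))) ⟩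
      (u * gₖ) * b₂ - (wP * gₖ) * b₁
        ≈⟨ +-cong (*-CS.x∙yz≈yx∙z gₖ u b₂) (-‿cong (*-CS.x∙yz≈yx∙z gₖ wP b₁)) ⟨
      gₖ * (u * b₂) - gₖ * (wP * b₁)
        ≈⟨ x[y-z]≈xy-xz gₖ _ _ ⟨
      gₖ * (u * b₂ - wP * b₁)
        ≈⟨ *-congˡ (*-basis n k z) ⟨
      gₖ * (z * basis n k z)
        ≈⟨ *-CS.xy∙z≈x∙zy gₖ _ _ ⟨
      (gₖ * basis n k z) * z ∎
      where
      u = node n k
      wP = a (-ℤ + k) * P a n k
      gₖ = g (+ k)
      b₁ = basis (suc n) k z
      b₂ = basis (suc n) (suc k) z

  eulerian : ℕ → ℤ → Carrier
  eulerian zero    (+ zero)   = 1#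
  eulerian zero    (+ suc _)  = 0#
  eulerian zero    -[1+ _ ]   = 0#
  eulerian (suc n) (+ k)      = recurrenceRHS (eulerian n) n k
  eulerian (suc n) -[1+ _ ]   = 0#

  eulerian-vanishes : ∀ n → VanishesOutside n (eulerian n)
  eulerian-vanishes zero    (+ zero)  (inj₁ (+<+ ()))
  eulerian-vanishes zero    (+ zero)  (inj₂ (+<+ ()))
  eulerian-vanishes zero    (+ suc _) _ = refl
  eulerian-vanishes zero    -[1+ _ ]  _ = refl
  eulerian-vanishes (suc n) (+ k)     (inj₁ (+<+ ()))
  eulerian-vanishes (suc n) (+ k)     (inj₂ (+<+ 1+n<k)) =
    recurrenceRHS-vanishes n (eulerian-vanishes n) 1+n<k
  eulerian-vanishes (suc n) -[1+ _ ]  _ = refl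

  eulerian-expansion : ∀ n → IsExpansion n (eulerian n ∘ +_)
  eulerian-expansion zero    z = sym (*-identityˡ 1#)
  eulerian-expansion (suc n) =
    expansion-suc n (eulerian-vanishes n) (eulerian-expansion n)

  isGenEulerian⇒eulerianRecurrence : ∀ A → IsGenEulerian a A → EulerianRecurrence a A
  isGenEulerian⇒eulerianRecurrence A (vanishes , expands) = vanishes , A₀₀≈1 , recurrence
    where
    A₀₀≈1 : A 0 (+ 0) ≈ 1#
    A₀₀≈1 = trans (sym (*-identityʳ _)) (sym (expands 0 1#))
    recurrence : ∀ n k → A (suc n) (+ k) ≈ recurrenceRHS (A n) n k
    recurrence n k with k ℕ.≤? suc n
    ... | yes k≤1+n = expansion-unique (suc n) (expands (suc n))
                        (expansion-suc n (vanishes n) (expands n)) k k≤1+n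
    ... | no  k≰1+n = trans (vanishes (suc n) (+ k) (inj₂ (+<+ (ℕP.≰⇒> k≰1+n))))
                            (sym (recurrenceRHS-vanishes n (vanishes n) (ℕP.≰⇒> k≰1+n)))

mainTheorem3 : {c ℓ : Level} (F : Field c ℓ) (a : ℤ → Field.Carrier F) →
    (∀ i j → Field._≈_ F (a i) (a j) → i ≡ j) →
    Σ _ (FieldOps.IsGenEulerian F a)
    × (∀ A → FieldOps.IsGenEulerian F a A → FieldOps.EulerianRecurrence F a A)
mainTheorem3 F a a-injective =
  (eulerian , eulerian-vanishes , eulerian-expansion) , isGenEulerian⇒eulerianRecurrence
  where open GeneralizedEulerian F a a-injective
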